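{- Let $m \geq 3$ and $l_1\le\cdots\le l_m$ be natural numbers, $H = B(l_1,\ldots,l_m)$ and $G = H^2$. Then $G$ is equitably $k$-choosable for every $k \geq m+3$.
   Context: $B(l_1,\ldots,l_m)$ denotes the graph with vertex set $\{u\}\cup\{v_{i,j}: i\in[m], j\in[l_i]\}$ where for each $i$ the vertices $u, v_{i,1},\ldots,v_{i,l_i}$ form a path in this order (a subdivision of $K_{1,m}$). $H^2$ is the square of $H$ (two vertices adjacent iff at distance at most 2 in $H$). A $k$-assignment $L$ assigns to each vertex a list of exactly $k$ colors; an equitable $L$-coloring of $G$ is a proper coloring $f$ with $f(v)\in L(v)$ using each color at most $\lceil |V(G)|/k\rceil$ times; $G$ is equitably $k$-choosable if it has an equitable $L$-coloring for every $k$-assignment $L$. -}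

module Defs where

open import Data.Nat using (ℕ; zero; suc; _+_; _≤_; _/_)
open import Data.Nat.Properties using (_≟_)
open import Data.Fin using (Fin; toℕ)
open import Data.List using (List; []; _∷_; map; concat; length; filter; allFin)
open import Data.List.Membership.Propositional using (_∈_)
open import Data.List.Relation.Unary.Unique.Propositional using (Unique)
open import Data.Product using (Σ; _×_)
open import Data.Sum using (_⊎_)
open import Relation.Binary.PropositionalEquality using (_≡_; _≢_)

-- Vertices of B(l_1,...,l_m), with l : Fin m → ℕ.
-- root is u;  br i j  is v_{i+1, j+1}  (i, j are 0-indexed).
data Vtx (m : ℕ) (l : Fin m → ℕ) : Set where
  root : Vtx m l
  br   : (i : Fin m) → Fin (l i) → Vtx m l

data Edge (m : ℕ) (l : Fin m → ℕ) : Vtx m l → Vtx m l → Set where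
  rootE : (i : Fin m) (j : Fin (l i)) → toℕ j ≡ 0 → Edge m l root (br i j)
  pathE : (i : Fin m) (j j' : Fin (l i)) → suc (toℕ j) ≡ toℕ j' →
          Edge m l (br i j) (br i j')

AdjH : (m : ℕ) (l : Fin m → ℕ) → Vtx m l → Vtx m l → Set
AdjH m l x y = Edge m l x y ⊎ Edge m l y x

AdjSq : (m : ℕ) (l : Fin m → ℕ) → Vtx m l → Vtx m l → Set
AdjSq m l x y =
  x ≢ y × (AdjH m l x y ⊎ Σ (Vtx m l) (λ w → AdjH m l x w × AdjH m l w y))

allVtx : (m : ℕ) (l : Fin m → ℕ) → List (Vtx m l)
allVtx m l = root ∷ concat (map (λ i → map (br i) (allFin (l i))) (allFin m))

nVtx : (m : ℕ) (l : Fin m → ℕ) → ℕ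
nVtx m l = length (allVtx m l)

-- ⌈ n / k ⌉  (value for k = 0 is irrelevant)
ceilDiv : ℕ → ℕ → ℕ
ceilDiv n zero    = zero
ceilDiv n (suc k) = (n + k) / suc k

colourCount : (m : ℕ) (l : Fin m → ℕ) → (Vtx m l → ℕ) → ℕ → ℕ
colourCount m l f c = length (filter (λ v → f v ≟ c) (allVtx m l))

IsKAssignment : (m : ℕ) (l : Fin m → ℕ) → ℕ → (Vtx m l → List ℕ) → Set
IsKAssignment m l k L = (v : Vtx m l) → Unique (L v) × length (L v) ≡ k

IsEquitableLColouring : (m : ℕ) (l : Fin m → ℕ) (k : ℕ) (L : Vtx m l → List ℕ) →
                        (Vtx m l → ℕ) → Set
IsEquitableLColouring m l k L f =
  ((v : Vtx m l) → f v ∈ L v) ×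
  ((x y : Vtx m l) → AdjSq m l x y → f x ≢ f y) ×
  ((c : ℕ) → colourCount m l f c ≤ ceilDiv (nVtx m l) k)

EquitablyChoosableSq : (m : ℕ) (l : Fin m → ℕ) → ℕ → Set
EquitablyChoosableSq m l k =
  (L : Vtx m l → List ℕ) → IsKAssignment m l k L →
  Σ (Vtx m l → ℕ) (IsEquitableLColouring m l k L)

-- Number the vertices of H = B(l₁,…,l_m): the root u at position 0, then the branches one
-- after another, and cut the positions into blocks of k consecutive numbers.  If the two
-- ends of every edge of G = H² and any two vertices of one block get distinct colours, each
-- colour is used at most once per block, hence at most ⌈n/k⌉ times.  We colour greedily,
-- block by block; inside a block first the root and the branch starts (a clique of G), then
-- the other vertices by decreasing number of back-neighbours (vertices one or two steps back
-- on the branch) in earlier blocks.  A vertex must avoid the colours of the earlier vertices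
-- of its block and of its earlier back-neighbours; the count `room` shows there are fewer
-- than k of them.  Its delicate case needs, in every full block, a vertex without outside
-- back-neighbours, found using m ≥ 3 and the monotonicity of the branch lengths.
module Submission where

open import Defs
open import Function using (_∘_; id)
open import Data.Nat using (ℕ; zero; suc; _+_; _*_; _∸_; _≤_; _<_; z≤n; s≤s; _/_; _%_)
open import Data.Nat.Properties
open import Data.Nat.DivMod
open import Data.Nat.Divisibility using (divides)
open import Data.Fin using (Fin; toℕ; fromℕ<) renaming (zero to fzero; suc to fsuc; _≤_ to _≤ᶠ_)
open import Data.Fin.Properties using (toℕ-injective; toℕ<n; toℕ-fromℕ<)
open import Data.List using (List; []; _∷_; map; length; filter; concat; tabulate; allFin; _++_; upTo; applyUpTo)
open import Data.List.Properties
  using (length-map; length-++; length-filter; length-tabulate; length-applyUpTo; length-upTo;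
         map-cong-local; map-tabulate; tabulate-cong; concat-map; map-∘; filter-complete; filter-none)
open import Data.List.Membership.Propositional using (_∈_; _∉_)
open import Data.List.Membership.Propositional.Properties
open import Data.List.Membership.DecPropositional _≟_ using (_∈?_)
open import Data.List.Relation.Unary.Any using (here; there)
open import Data.List.Relation.Unary.All as All using (All; []; _∷_)
open import Data.List.Relation.Unary.AllPairs using ([]; _∷_)
open import Data.List.Relation.Unary.Unique.Propositional using (Unique)
import Data.List.Relation.Unary.Unique.Propositional.Properties as Unique
open import Data.Product using (Σ; _×_; _,_; proj₁; proj₂)
open import Data.Sum using (_⊎_; inj₁; inj₂)
open import Data.Empty using (⊥-elim)
open import Relation.Nullary using (Dec; yes; no)
open import Relation.Nullary.Decidable using (map′; _×-dec_; _⊎-dec_; ¬?)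
open import Relation.Unary using (Decidable)
open import Relation.Binary.Definitions using (DecidableEquality; tri<; tri≈; tri>)
open import Relation.Binary.PropositionalEquality
  using (_≡_; _≢_; refl; sym; trans; cong; cong₂; subst; subst₂; module ≡-Reasoning)

unique-⊆-length : {A : Set} {xs ys : List A} → Unique xs →
                  (∀ {z} → z ∈ xs → z ∈ ys) → length xs ≤ length ys
unique-⊆-length {xs = []} _ _ = z≤n
unique-⊆-length {xs = x ∷ xs} (x∉xs ∷ xs-unique) xs⊆ys with ∈-∃++ (xs⊆ys (here refl))
... | as , bs , refl = begin
    suc (length xs)             ≤⟨ s≤s (unique-⊆-length xs-unique drop-x) ⟩
    suc (length (as ++ bs))     ≡⟨ cong suc (length-++ as) ⟩
    suc (length as + length bs) ≡⟨ +-suc (length as) (length bs) ⟨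
    length as + length (x ∷ bs) ≡⟨ length-++ as ⟨
    length (as ++ x ∷ bs)       ∎
  where
  open ≤-Reasoning
  drop-x : ∀ {z} → z ∈ xs → z ∈ as ++ bs
  drop-x {z} z∈xs with ∈-++⁻ as (xs⊆ys (there z∈xs))
  ... | inj₁ z∈as         = ∈-++⁺ˡ z∈as
  ... | inj₂ (here refl)  = ⊥-elim (All.lookup x∉xs z∈xs refl)
  ... | inj₂ (there z∈bs) = ∈-++⁺ʳ as z∈bs

unique-map : {A B : Set} (g : A → B) {xs : List A} → Unique xs →
             (∀ {x y} → x ∈ xs → y ∈ xs → g x ≡ g y → x ≡ y) → Unique (map g xs)
unique-map g {[]} _ _ = []
unique-map g {x ∷ xs} (x∉xs ∷ xs-unique) injective =
  All.tabulate fresh ∷ unique-map g xs-unique (λ p q → injective (there p) (there q))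
  where
  fresh : ∀ {z} → z ∈ map g xs → g x ≢ z
  fresh z∈ gx≡z with ∈-map⁻ g z∈
  ... | y , y∈xs , refl = All.lookup x∉xs y∈xs (injective (here refl) (there y∈xs) gx≡z)

injection-length : {A B : Set} (g : A → B) {xs : List A} {ys : List B} → Unique xs →
                   (∀ {x y} → x ∈ xs → y ∈ xs → g x ≡ g y → x ≡ y) →
                   (∀ {x} → x ∈ xs → g x ∈ ys) → length xs ≤ length ys
injection-length g {xs} {ys} xs-unique injective into =
  subst (_≤ _) (length-map g xs) (unique-⊆-length (unique-map g xs-unique injective) image⊆)
  where
  image⊆ : ∀ {z} → z ∈ map g xs → z ∈ ys
  image⊆ z∈ with ∈-map⁻ g z∈
  ... | x , x∈xs , refl = into x∈xs

unique-map⇒injective : {A B : Set} (g : A → B) {xs : List A} → Unique (map g xs) →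
                       ∀ {x y} → x ∈ xs → y ∈ xs → g x ≡ g y → x ≡ y
unique-map⇒injective g {_ ∷ _} _ (here refl) (here refl) _ = refl
unique-map⇒injective g {_ ∷ _} (fresh ∷ _) (here refl) (there q) e = ⊥-elim (All.lookup fresh (∈-map⁺ g q) e)
unique-map⇒injective g {_ ∷ _} (fresh ∷ _) (there p) (here refl) e = ⊥-elim (All.lookup fresh (∈-map⁺ g p) (sym e))
unique-map⇒injective g {_ ∷ _} (_ ∷ u) (there p) (there q) e = unique-map⇒injective g u p q e

filter-keeps-all : {A : Set} {P : A → Set} (P? : Decidable P) (xs : List A) →
                   length (filter P? xs) ≡ length xs → ∀ {z} → z ∈ xs → P z
filter-keeps-all P? xs kept z∈ = proj₂ (∈-filter⁻ P? {xs = xs} (subst (_ ∈_) (sym (filter-complete P? kept)) z∈))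

member-of-nonempty : {A : Set} (ys : List A) → 1 ≤ length ys → Σ A (_∈ ys)
member-of-nonempty (y ∷ _) _ = y , here refl

interval : ℕ → ℕ → List ℕ
interval a c = applyUpTo (a +_) c

∈-interval : ∀ {a c q} → a ≤ q → q < a + c → q ∈ interval a c
∈-interval {a} {c} {q} a≤q q<a+c = subst (_∈ interval a c) (m+[n∸m]≡n a≤q)
  (∈-applyUpTo⁺ (a +_) (+-cancelˡ-< a (q ∸ a) c (subst (_< a + c) (sym (m+[n∸m]≡n a≤q)) q<a+c)))

firstNotIn : List ℕ → List ℕ → ℕ
firstNotIn [] ys = 0
firstNotIn (x ∷ xs) ys with x ∈? ys
... | yes _ = firstNotIn xs ys
... | no _  = x

firstNotIn-spec : ∀ xs ys → (firstNotIn xs ys ∈ xs × firstNotIn xs ys ∉ ys) ⊎ (∀ {z} → z ∈ xs → z ∈ ys)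
firstNotIn-spec [] ys = inj₂ (λ ())
firstNotIn-spec (x ∷ xs) ys with x ∈? ys
... | no x∉ys = inj₁ (here refl , x∉ys)
... | yes x∈ys with firstNotIn-spec xs ys
...   | inj₁ (found , fresh) = inj₁ (there found , fresh)
...   | inj₂ covered = inj₂ λ { (here refl) → x∈ys ; (there z∈xs) → covered z∈xs }

firstNotIn-fresh : ∀ xs ys → Unique xs → length ys < length xs →
                   firstNotIn xs ys ∈ xs × firstNotIn xs ys ∉ ys
firstNotIn-fresh xs ys xs-unique shorter with firstNotIn-spec xs ys
... | inj₁ found   = found
... | inj₂ covered = ⊥-elim (<⇒≱ shorter (unique-⊆-length xs-unique covered))

-- The recursion on the rank is run with explicit fuel.
module GreedyColouring {V : Set} (rank : V → ℕ) (earlier : V → List V)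
  (earlier-rank : ∀ {x y} → y ∈ earlier x → rank y < rank x)
  (L : V → List ℕ) (L-unique : ∀ x → Unique (L x))
  (room : ∀ x → length (earlier x) < length (L x)) where

  colourWithFuel : ℕ → V → ℕ
  colourWithFuel zero    x = 0
  colourWithFuel (suc s) x = firstNotIn (L x) (map (colourWithFuel s) (earlier x))

  fuel-irrelevant : ∀ s t x → rank x < s → rank x < t → colourWithFuel s x ≡ colourWithFuel t x
  fuel-irrelevant (suc s) (suc t) x (s≤s rx≤s) (s≤s rx≤t) =
    cong (firstNotIn (L x)) (map-cong-local (All.tabulate agree))
    where
    agree : ∀ {y} → y ∈ earlier x → colourWithFuel s y ≡ colourWithFuel t y
    agree y∈ = fuel-irrelevant s t _ (<-≤-trans (earlier-rank y∈) rx≤s) (<-≤-trans (earlier-rank y∈) rx≤t)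

  -- Fuel rank x + 1 suffices, since ranks decrease along `earlier`.
  colour : V → ℕ
  colour x = colourWithFuel (suc (rank x)) x

  colour-unfold : ∀ x → colour x ≡ firstNotIn (L x) (map colour (earlier x))
  colour-unfold x = cong (firstNotIn (L x)) (map-cong-local (All.tabulate agree))
    where
    agree : ∀ {y} → y ∈ earlier x → colourWithFuel (rank x) y ≡ colour y
    agree y∈ = fuel-irrelevant _ _ _ (earlier-rank y∈) ≤-refl

  colour-fresh : ∀ x → colour x ∈ L x × colour x ∉ map colour (earlier x)
  colour-fresh x rewrite colour-unfold x =
    firstNotIn-fresh (L x) _ (L-unique x) (subst (_< length (L x)) (sym (length-map colour (earlier x))) (room x))

greedy-colouring : {V : Set} (rank : V → ℕ) (earlier : V → List V) →
  (∀ {x y} → y ∈ earlier x → rank y < rank x) →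
  (L : V → List ℕ) → (∀ x → Unique (L x)) → (∀ x → length (earlier x) < length (L x)) →
  Σ (V → ℕ) λ f → (∀ x → f x ∈ L x) × (∀ {x y} → y ∈ earlier x → f y ≢ f x)
greedy-colouring rank earlier earlier-rank L L-unique room =
  colour , (λ x → proj₁ (colour-fresh x)) ,
  (λ {x} y∈ fy≡fx → proj₂ (colour-fresh x) (subst (_∈ map colour (earlier x)) fy≡fx (∈-map⁺ colour y∈)))
  where open GreedyColouring rank earlier earlier-rank L L-unique room

lex-< : ∀ N a a' p p' → p < N → a < a' → a * N + p < a' * N + p'
lex-< N a a' p p' p<N a<a' = begin-strict
  a * N + p  <⟨ +-monoʳ-< (a * N) p<N ⟩
  a * N + N  ≡⟨ +-comm (a * N) N ⟩
  suc a * N  ≤⟨ *-monoˡ-≤ N a<a' ⟩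
  a' * N     ≤⟨ m≤m+n (a' * N) p' ⟩
  a' * N + p' ∎
  where open ≤-Reasoning

lex-<⁻ : ∀ N a a' p p' → p' < N → a * N + p < a' * N + p' → a < a' ⊎ (a ≡ a' × p < p')
lex-<⁻ N a a' p p' p'<N lt with <-cmp a a'
... | tri< a<a' _ _ = inj₁ a<a'
... | tri≈ _ refl _ = inj₂ (refl , +-cancelˡ-< (a * N) p p' lt)
... | tri> _ _ a>a' = ⊥-elim (<-asym lt (lex-< N a' a p' p p'<N a>a'))

lex-injective : ∀ N a a' p p' → p < N → p' < N → a * N + p ≡ a' * N + p' → a ≡ a' × p ≡ p'
lex-injective N a a' p p' p<N p'<N eq with <-cmp a a'
... | tri< a<a' _ _ = ⊥-elim (<⇒≢ (lex-< N a a' p p' p<N a<a') eq)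
... | tri≈ _ refl _ = refl , +-cancelˡ-≡ (a * N) p p' eq
... | tri> _ _ a>a' = ⊥-elim (<⇒≢ (lex-< N a' a p' p p'<N a>a') (sym eq))

module Blocks (k' : ℕ) where

  k : ℕ
  k = suc k'

  block slot : ℕ → ℕ
  block q = q / k
  slot  q = q % k

  slot<k : ∀ q → slot q < k
  slot<k q = m%n<n q k

  block-slot : ∀ q → q ≡ slot q + block q * k
  block-slot q = m≡m%n+[m/n]*n q k

  block-of : ∀ b r → r < k → block (r + b * k) ≡ b
  block-of b r r<k = trans (+-distrib-/-∣ʳ r (divides b refl)) (cong₂ _+_ (m<n⇒m/n≡0 r<k) (m*n/n≡m b k))

  slot-of : ∀ b r → r < k → slot (r + b * k) ≡ r
  slot-of b r r<k = trans ([m+kn]%n≡m%n r b k) (m<n⇒m%n≡m r<k)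

  block-mono : ∀ {q q'} → q ≤ q' → block q ≤ block q'
  block-mono = /-monoˡ-≤ k

  block-slot-injective : ∀ {p q} → block p ≡ block q → slot p ≡ slot q → p ≡ q
  block-slot-injective {p} {q} same-block same-slot =
    trans (block-slot p) (trans (cong₂ (λ r b → r + b * k) same-slot same-block) (sym (block-slot q)))

  block-∸ : ∀ q a → a ≤ slot q → block (q ∸ a) ≡ block q
  block-∸ q a a≤slot = trans (cong block q∸a) (block-of (block q) (slot q ∸ a) (≤-<-trans (m∸n≤m (slot q) a) (slot<k q)))
    where
    q∸a : q ∸ a ≡ (slot q ∸ a) + block q * k
    q∸a = trans (cong (_∸ a) (block-slot q)) (+-∸-comm (block q * k) a≤slot)

  block-bounds : ∀ q → block q * k ≤ q × q < block q * k + k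
  block-bounds q = subst (block q * k ≤_) (sym (block-slot q)) (m≤n+m _ (slot q)) ,
                   subst (_< block q * k + k) (trans (+-comm _ (slot q)) (sym (block-slot q)))
                         (+-monoʳ-< (block q * k) (slot<k q))

  block<ceilDiv : ∀ q N → q < N → block q < ceilDiv N k
  block<ceilDiv q N q<N = begin-strict
    block q              <⟨ n<1+n (block q) ⟩
    suc (block q)        ≡⟨ block-of (suc (block q)) (slot q) (slot<k q) ⟨
    block (slot q + suc (block q) * k) ≡⟨ cong block q+k ⟨
    block (q + k)        ≤⟨ block-mono (subst (_≤ N + k') (sym (+-suc q k')) (+-monoˡ-≤ k' q<N)) ⟩
    ceilDiv N k          ∎
    where
    open ≤-Reasoning
    q+k : q + k ≡ slot q + suc (block q) * k
    q+k = trans (cong (_+ k) (block-slot q)) (trans (+-assoc (slot q) _ k) (cong (slot q +_) (+-comm _ k)))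

  one-per-block : {A : Set} (pos : A → ℕ) (N : ℕ) {xs : List A} → Unique xs →
                  (∀ {x} → x ∈ xs → pos x < N) →
                  (∀ {x y} → x ∈ xs → y ∈ xs → block (pos x) ≡ block (pos y) → x ≡ y) →
                  length xs ≤ ceilDiv N k
  one-per-block pos N xs-unique below injective =
    subst (_ ≤_) (length-applyUpTo id (ceilDiv N k))
      (injection-length (block ∘ pos) xs-unique injective (λ x∈ → ∈-upTo⁺ (block<ceilDiv _ N (below x∈))))

  block-capacity : {A : Set} (pos : A → ℕ) → (∀ {x y} → pos x ≡ pos y → x ≡ y) →
                   ∀ b c {xs : List A} → Unique xs → (∀ {x} → x ∈ xs → block (pos x) ≡ b) →
                   (∀ {x} → x ∈ xs → pos x < b * k + c) → length xs ≤ c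
  block-capacity pos pos-injective b c {xs} xs-unique in-b before-c =
    subst (_ ≤_) (length-applyUpTo (b * k +_) c)
      (injection-length pos xs-unique (λ _ _ → pos-injective) into)
    where
    into : ∀ {x} → x ∈ xs → pos x ∈ interval (b * k) c
    into {x} x∈ = ∈-interval (subst (λ b' → b' * k ≤ pos x) (in-b x∈) (proj₁ (block-bounds (pos x)))) (before-c x∈)

offset : ∀ {m} → (Fin m → ℕ) → Fin m → ℕ
offset l fzero    = 0
offset l (fsuc i) = l fzero + offset (l ∘ fsuc) i

total : ∀ {m} → (Fin m → ℕ) → ℕ
total {zero}  l = 0
total {suc m} l = l fzero + total (l ∘ fsuc)

offset-short : ∀ {m} (l : Fin m → ℕ) (i : Fin m) → (∀ i' → toℕ i' < toℕ i → l i' ≤ 2) →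
               offset l i ≤ toℕ i + toℕ i
offset-short l fzero    short = z≤n
offset-short l (fsuc i) short = begin
  l fzero + offset (l ∘ fsuc) i  ≤⟨ +-mono-≤ (short fzero (s≤s z≤n)) (offset-short (l ∘ fsuc) i (λ i' → short (fsuc i') ∘ s≤s)) ⟩
  2 + (toℕ i + toℕ i)            ≡⟨ cong suc (+-suc (toℕ i) (toℕ i)) ⟨
  suc (toℕ i + suc (toℕ i))      ∎
  where open ≤-Reasoning

applyUpTo-+ : {A : Set} (f : ℕ → A) (a b : ℕ) → applyUpTo f (a + b) ≡ applyUpTo f a ++ applyUpTo (f ∘ (a +_)) b
applyUpTo-+ f zero    b = refl
applyUpTo-+ f (suc a) b = cong (f 0 ∷_) (applyUpTo-+ (f ∘ suc) a b)

tabulate-toℕ : {A : Set} (f : ℕ → A) (c : ℕ) → tabulate {n = c} (f ∘ toℕ) ≡ applyUpTo f c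
tabulate-toℕ f zero    = refl
tabulate-toℕ f (suc c) = cong (f 0 ∷_) (tabulate-toℕ (f ∘ suc) c)

branches-enumerate : ∀ {A : Set} {m} (l : Fin m → ℕ) (f : ℕ → A) →
  concat (tabulate {n = m} (λ i → tabulate {n = l i} (λ j → f (offset l i + toℕ j)))) ≡ applyUpTo f (total l)
branches-enumerate {m = zero}  l f = refl
branches-enumerate {m = suc m} l f = begin
  tabulate (f ∘ toℕ) ++ concat (tabulate {n = m} (λ i → tabulate {n = l (fsuc i)} (λ j → f ((l fzero + offset (l ∘ fsuc) i) + toℕ j))))
    ≡⟨ cong₂ _++_ (tabulate-toℕ f (l fzero))
         (cong concat (tabulate-cong {n = m} (λ i → tabulate-cong {n = l (fsuc i)} (λ j →
            cong f (+-assoc (l fzero) (offset (l ∘ fsuc) i) (toℕ j)))))) ⟩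
  applyUpTo f (l fzero) ++ concat (tabulate {n = m} (λ i → tabulate {n = l (fsuc i)} (λ j → f (l fzero + (offset (l ∘ fsuc) i + toℕ j)))))
    ≡⟨ cong (applyUpTo f (l fzero) ++_) (branches-enumerate (l ∘ fsuc) (f ∘ (l fzero +_))) ⟩
  applyUpTo f (l fzero) ++ applyUpTo (f ∘ (l fzero +_)) (total (l ∘ fsuc))
    ≡⟨ applyUpTo-+ f (l fzero) (total (l ∘ fsuc)) ⟨
  applyUpTo f (total l) ∎
  where open ≡-Reasoning

module BranchTree (m : ℕ) (l : Fin m → ℕ) (nonempty : ∀ i → 1 ≤ l i) where

  V : Set
  V = Vtx m l

  n : ℕ
  n = nVtx m l

  pos : V → ℕ
  pos root     = 0
  pos (br i j) = suc (offset l i + toℕ j)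

  positions : map pos (allVtx m l) ≡ upTo n
  positions = trans enumerate (cong upTo (sym size))
    where
    open ≡-Reasoning
    enumerate : map pos (allVtx m l) ≡ upTo (suc (total l))
    enumerate = cong (0 ∷_) (begin
      map pos (concat (map (λ i → map (br i) (allFin (l i))) (allFin m)))
        ≡⟨ concat-map (map (λ i → map (br i) (allFin (l i))) (allFin m)) ⟨
      concat (map (map pos) (map (λ i → map (br i) (allFin (l i))) (allFin m)))
        ≡⟨ cong concat (map-∘ (allFin m)) ⟨
      concat (map (λ i → map pos (map (br i) (allFin (l i)))) (allFin m))
        ≡⟨ cong concat (map-tabulate {n = m} id _) ⟩
      concat (tabulate {n = m} (λ i → map pos (map (br i) (allFin (l i)))))
        ≡⟨ cong concat (tabulate-cong (λ i → trans (sym (map-∘ (allFin (l i)))) (map-tabulate id _))) ⟩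
      concat (tabulate {n = m} (λ i → tabulate {n = l i} (λ j → suc (offset l i + toℕ j))))
        ≡⟨ branches-enumerate l suc ⟩
      applyUpTo suc (total l) ∎)
    size : n ≡ suc (total l)
    size = trans (sym (length-map pos (allVtx m l))) (trans (cong length enumerate) (length-upTo _))

  allVtx-complete : ∀ v → v ∈ allVtx m l
  allVtx-complete root     = here refl
  allVtx-complete (br i j) = there (∈-concat⁺′ (∈-map⁺ (br i) (∈-allFin j))
                                               (∈-map⁺ (λ i → map (br i) (allFin (l i))) (∈-allFin i)))

  allVtx-unique : Unique (allVtx m l)
  allVtx-unique = Unique.map⁻ (subst Unique (sym positions) (Unique.upTo⁺ n))

  pos-injective : ∀ {x y} → pos x ≡ pos y → x ≡ y
  pos-injective = unique-map⇒injective pos (subst Unique (sym positions) (Unique.upTo⁺ n))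
                    (allVtx-complete _) (allVtx-complete _)

  pos<n : ∀ v → pos v < n
  pos<n v = ∈-upTo⁻ (subst (pos v ∈_) positions (∈-map⁺ pos (allVtx-complete v)))

  vertexAt : ∀ q → q < n → Σ V (λ v → pos v ≡ q)
  vertexAt q q<n with ∈-map⁻ pos (subst (q ∈_) (sym positions) (∈-upTo⁺ q<n))
  ... | v , _ , q≡pos = v , sym q≡pos

  _≟V_ : DecidableEquality V
  x ≟V y = map′ pos-injective (cong pos) (pos x ≟ pos y)

  data Shape : V → Set where
    root-shape  : Shape root
    start-shape : ∀ i j → toℕ j ≡ 0 → Shape (br i j)
    inner-shape : ∀ i j t → toℕ j ≡ suc t → Shape (br i j)

  shape : ∀ x → Shape x
  shape root = root-shape
  shape (br i j) with toℕ j in e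
  ... | zero  = start-shape i j e
  ... | suc t = inner-shape i j t e

  start : Fin m → V
  start i = br i (fromℕ< (nonempty i))

  starts : List V
  starts = map start (allFin m)

  starts-length : length starts ≡ m
  starts-length = trans (length-map start (allFin m)) (length-tabulate id)

  start∈starts : ∀ i j → toℕ j ≡ 0 → br i j ∈ starts
  start∈starts i j j≡0 =
    subst (_∈ starts) (cong (br i) (toℕ-injective (trans (toℕ-fromℕ< (nonempty i)) (sym j≡0))))
      (∈-map⁺ start (∈-allFin i))

  back1 back2 : (i : Fin m) → Fin (l i) → V
  back1 i j = br i (fromℕ< (≤-<-trans (m∸n≤m (toℕ j) 1) (toℕ<n j)))
  back2 i j = br i (fromℕ< (≤-<-trans (m∸n≤m (toℕ j) 2) (toℕ<n j)))

  back1-of : ∀ i j j' → suc (toℕ j) ≡ toℕ j' → back1 i j' ≡ br i j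
  back1-of i j j' e = cong (br i) (toℕ-injective (trans (toℕ-fromℕ< _) (cong (_∸ 1) (sym e))))

  back2-of : ∀ i j j' → suc (suc (toℕ j)) ≡ toℕ j' → back2 i j' ≡ br i j
  back2-of i j j' e = cong (br i) (toℕ-injective (trans (toℕ-fromℕ< _) (cong (_∸ 2) (sym e))))

  second : (i : Fin m) → Fin (l i) → ℕ → V
  second i j zero    = root
  second i j (suc _) = back2 i j

  -- Back-neighbours of br i j at depth d: the earlier vertices within distance 2 in H,
  -- except that a branch start records the root and all starts.
  backNbrsAt : (i : Fin m) → Fin (l i) → ℕ → List V
  backNbrsAt i j zero    = root ∷ starts
  backNbrsAt i j (suc t) = back1 i j ∷ second i j t ∷ []

  backNbrs : V → List V
  backNbrs root     = []
  backNbrs (br i j) = backNbrsAt i j (toℕ j)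

  backNbrs-br : ∀ i j {d} → toℕ j ≡ d → backNbrs (br i j) ≡ backNbrsAt i j d
  backNbrs-br i j = cong (backNbrsAt i j)

  pos-back1 : ∀ i j t → toℕ j ≡ suc t → pos (back1 i j) ≡ pos (br i j) ∸ 1
  pos-back1 i j t e = begin
    suc (offset l i + toℕ (fromℕ< _)) ≡⟨ cong (λ d → suc (offset l i + d)) (trans (toℕ-fromℕ< _) (cong (_∸ 1) e)) ⟩
    suc (offset l i + t)              ≡⟨ +-suc (offset l i) t ⟨
    offset l i + suc t                ≡⟨ cong (offset l i +_) e ⟨
    pos (br i j) ∸ 1                  ∎
    where open ≡-Reasoning

  pos-back2 : ∀ i j t → toℕ j ≡ suc (suc t) → pos (back2 i j) ≡ pos (br i j) ∸ 2
  pos-back2 i j t e = begin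
    suc (offset l i + toℕ (fromℕ< _)) ≡⟨ cong (λ d → suc (offset l i + d)) (trans (toℕ-fromℕ< _) (cong (_∸ 2) e)) ⟩
    suc (offset l i + t)              ≡⟨ +-suc (offset l i) t ⟨
    offset l i + suc t                ≡⟨ cong (_∸ 1) (+-suc (offset l i) (suc t)) ⟨
    offset l i + suc (suc t) ∸ 1      ≡⟨ cong (λ d → offset l i + d ∸ 1) e ⟨
    pos (br i j) ∸ 2                  ∎
    where open ≡-Reasoning

  backNbrs-earlier : ∀ i j t → toℕ j ≡ suc t → ∀ {y} → y ∈ backNbrs (br i j) → pos y < pos (br i j)
  backNbrs-earlier i j t e y∈ with subst (_ ∈_) (backNbrs-br i j e) y∈
  ... | here refl = subst (_< pos (br i j)) (sym (pos-back1 i j t e)) ≤-refl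
  ... | there (here refl) = second-earlier t e
    where
    second-earlier : ∀ t → toℕ j ≡ suc t → pos (second i j t) < pos (br i j)
    second-earlier zero    _ = s≤s z≤n
    second-earlier (suc t) e = subst (_< pos (br i j)) (sym (pos-back2 i j t e)) (s≤s (m∸n≤m _ 1))

  Recorded : V → V → Set
  Recorded y x = y ∈ backNbrs x × (pos y < pos x ⊎ x ∈ backNbrs y)

  parent-recorded : ∀ {a b} → Edge m l a b → Recorded a b
  parent-recorded (rootE i j j≡0) =
    subst (root ∈_) (sym (backNbrs-br i j j≡0)) (here refl) , inj₁ (s≤s z≤n)
  parent-recorded (pathE i j j' e) =
    subst (_∈ backNbrs (br i j')) (back1-of i j j' e) (subst (back1 i j' ∈_) (sym (backNbrs-br i j' (sym e))) (here refl)) ,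
    inj₁ (s≤s (+-monoʳ-< (offset l i) (subst (toℕ j <_) e ≤-refl)))

  grandparent-recorded : ∀ {a b c} → Edge m l a b → Edge m l b c → Recorded a c
  grandparent-recorded (rootE i j j≡0) (pathE .i .j j' e) =
    subst (root ∈_) (sym (backNbrs-br i j' (trans (sym e) (cong suc j≡0)))) (there (here refl)) , inj₁ (s≤s z≤n)
  grandparent-recorded (pathE i j j' e) (pathE .i .j' j'' e') =
    subst (_∈ backNbrs (br i j'')) (back2-of i j j'' e'')
      (subst (back2 i j'' ∈_) (sym (backNbrs-br i j'' (sym e''))) (there (here refl))) ,
    inj₁ (s≤s (+-monoʳ-< (offset l i) (subst (toℕ j <_) e'' (s≤s (n≤1+n _)))))
    where
    e'' : suc (suc (toℕ j)) ≡ toℕ j''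
    e'' = trans (cong suc e) e'

  sibling-recorded : ∀ {a b c} → Edge m l a b → Edge m l a c → b ≢ c → Recorded b c
  sibling-recorded (rootE i j j≡0) (rootE i' j' j'≡0) _ =
    subst (br i j ∈_) (sym (backNbrs-br i' j' j'≡0)) (there (start∈starts i j j≡0)) ,
    inj₂ (subst (br i' j' ∈_) (sym (backNbrs-br i j j≡0)) (there (start∈starts i' j' j'≡0)))
  sibling-recorded (pathE i j j' e) (pathE .i .j j'' e') b≢c =
    ⊥-elim (b≢c (cong (br i) (toℕ-injective (trans (sym e) e'))))

  parent-unique : ∀ {a b c} → Edge m l a c → Edge m l b c → a ≡ b
  parent-unique (rootE i j _)      (rootE .i .j _)       = refl
  parent-unique (rootE i j j≡0)    (pathE .i _ .j e)     = ⊥-elim (1+n≢0 (trans e j≡0))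
  parent-unique (pathE i _ j e)    (rootE .i .j j≡0)     = ⊥-elim (1+n≢0 (trans e j≡0))
  parent-unique (pathE i j₁ j e)   (pathE .i j₂ .j e')   = cong (br i) (toℕ-injective (suc-injective (trans e (sym e'))))

  square-edge-recorded : ∀ {x y} → AdjSq m l x y → Recorded x y ⊎ Recorded y x
  square-edge-recorded (_   , inj₁ (inj₁ xy))                  = inj₁ (parent-recorded xy)
  square-edge-recorded (_   , inj₁ (inj₂ yx))                  = inj₂ (parent-recorded yx)
  square-edge-recorded (_   , inj₂ (_ , inj₁ xw , inj₁ wy))    = inj₁ (grandparent-recorded xw wy)
  square-edge-recorded (x≢y , inj₂ (_ , inj₁ xw , inj₂ yw))    = ⊥-elim (x≢y (parent-unique xw yw))
  square-edge-recorded (x≢y , inj₂ (_ , inj₂ wx , inj₁ wy))    = inj₁ (sibling-recorded wx wy x≢y)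
  square-edge-recorded (_   , inj₂ (_ , inj₂ wx , inj₂ yw))    = inj₂ (grandparent-recorded yw wx)

  depth-of-≡ : ∀ {i i'} {a : Fin (l i)} {b : Fin (l i')} → br i a ≡ br i' b → toℕ a ≡ toℕ b
  depth-of-≡ refl = refl

  -- For non-decreasing branch lengths: if the vertex just before the start of branch i has
  -- depth at most 1, then every earlier branch has length at most 2, so that start is early.
  short-prefix : (∀ i i' → toℕ i ≤ toℕ i' → l i ≤ l i') →
                 ∀ i i' (j' : Fin (l i')) → toℕ j' ≤ 1 → pos (br i' j') ≡ offset l i → offset l i ≤ m + m
  short-prefix mono i i' j' j'≤1 just-before with suc (toℕ j') <? l i'
  ... | yes next-exists = ⊥-elim (1+n≢0 (begin
        suc (toℕ j')              ≡⟨ toℕ-fromℕ< next-exists ⟨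
        toℕ (fromℕ< next-exists)  ≡⟨ depth-of-≡ (pos-injective next≡start) ⟩
        toℕ (fromℕ< (nonempty i)) ≡⟨ toℕ-fromℕ< (nonempty i) ⟩
        0                          ∎))
    where
    open ≡-Reasoning
    next≡start : pos (br i' (fromℕ< next-exists)) ≡ pos (start i)
    next≡start = begin
      suc (offset l i' + toℕ (fromℕ< next-exists)) ≡⟨ cong (λ d → suc (offset l i' + d)) (toℕ-fromℕ< next-exists) ⟩
      suc (offset l i' + suc (toℕ j'))             ≡⟨ cong suc (+-suc (offset l i') (toℕ j')) ⟩
      suc (pos (br i' j'))                         ≡⟨ cong suc just-before ⟩
      suc (offset l i)                             ≡⟨ cong suc (+-identityʳ (offset l i)) ⟨
      suc (offset l i + 0)                         ≡⟨ cong (λ d → suc (offset l i + d)) (toℕ-fromℕ< (nonempty i)) ⟨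
      pos (start i)                                ∎
  ... | no last = begin
        offset l i                          ≡⟨ just-before ⟨
        suc (offset l i' + toℕ j')          ≤⟨ s≤s (+-mono-≤ (offset-short l i' short) j'≤1) ⟩
        suc ((toℕ i' + toℕ i') + 1)         ≡⟨ cong suc (+-comm (toℕ i' + toℕ i') 1) ⟩
        suc (suc (toℕ i' + toℕ i'))         ≡⟨ cong suc (+-suc (toℕ i') (toℕ i')) ⟨
        suc (toℕ i') + suc (toℕ i')         ≤⟨ +-mono-≤ (toℕ<n i') (toℕ<n i') ⟩
        m + m                               ∎
    where
    open ≤-Reasoning
    short : ∀ i'' → toℕ i'' < toℕ i' → l i'' ≤ 2
    short i'' i''<i' = ≤-trans (mono i'' i' (<⇒≤ i''<i')) (≤-trans (≮⇒≥ last) (s≤s j'≤1))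

module Ordering (m : ℕ) (3≤m : 3 ≤ m) (l : Fin m → ℕ) (nonempty : ∀ i → 1 ≤ l i)
  (mono : ∀ i i' → toℕ i ≤ toℕ i' → l i ≤ l i') (k' : ℕ) (m+3≤k : m + 3 ≤ suc k') where

  open BranchTree m l nonempty
  open Blocks k'

  m+2≤k' : m + 2 ≤ k'
  m+2≤k' = ≤-pred (subst (_≤ suc k') (+-suc m 2) m+3≤k)

  2≤k' : 2 ≤ k'
  2≤k' = ≤-trans (m≤n+m 2 m) m+2≤k'

  k≤b*k : ∀ b → 1 ≤ b → k ≤ b * k
  k≤b*k b 1≤b = subst (_≤ b * k) (*-identityˡ k) (*-monoˡ-≤ k 1≤b)

  blockOf : V → ℕ
  blockOf x = block (pos x)

  outside? : (x y : V) → Dec (blockOf y ≢ blockOf x)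
  outside? x y = ¬? (blockOf y ≟ blockOf x)

  outsideNbrs : V → List V
  outsideNbrs x = filter (outside? x) (backNbrs x)

  outDeg : V → ℕ
  outDeg x = length (outsideNbrs x)

  -- Order of treatment inside a block: root and starts first (class 0), then inner vertices
  -- by decreasing number of outside back-neighbours (class 3 ∸ outDeg).
  classAt : ℕ → ℕ → ℕ
  classAt zero    _ = 0
  classAt (suc _) d = 3 ∸ d

  class : V → ℕ
  class root     = 0
  class (br i j) = classAt (toℕ j) (outDeg (br i j))

  key : V → ℕ
  key x = blockOf x * 4 + class x

  rank : V → ℕ
  rank x = key x * n + pos x

  -- Classes are below 4, so the rank encodes (block, class, position) lexicographically.
  class<4 : ∀ x → class x < 4
  class<4 root     = s≤s z≤n
  class<4 (br i j) = classAt<4 (toℕ j) (outDeg (br i j))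
    where
    classAt<4 : ∀ a d → classAt a d < 4
    classAt<4 zero    d = s≤s z≤n
    classAt<4 (suc a) d = s≤s (m∸n≤m 3 d)

  rank-class< : ∀ {x y} → blockOf y ≡ blockOf x → class y < class x → rank y < rank x
  rank-class< {x} {y} same lt = lex-< n (key y) (key x) (pos y) (pos x) (pos<n y)
    (subst (λ b → b * 4 + class y < blockOf x * 4 + class x) (sym same) (+-monoʳ-< (blockOf x * 4) lt))

  rank<-view : ∀ {x y} → rank y < rank x →
    blockOf y < blockOf x ⊎ (blockOf y ≡ blockOf x × (class y < class x ⊎ (class y ≡ class x × pos y < pos x)))
  rank<-view {x} {y} lt with lex-<⁻ n (key y) (key x) (pos y) (pos x) (pos<n x) lt
  ... | inj₂ (key≡ , pos<) = inj₂ (proj₁ keys , inj₂ (proj₂ keys , pos<))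
    where
    keys : blockOf y ≡ blockOf x × class y ≡ class x
    keys = lex-injective 4 (blockOf y) (blockOf x) (class y) (class x) (class<4 y) (class<4 x) key≡
  ... | inj₁ key< with lex-<⁻ 4 (blockOf y) (blockOf x) (class y) (class x) (class<4 x) key<
  ...   | inj₁ block<          = inj₁ block<
  ...   | inj₂ (same , class<) = inj₂ (same , inj₁ class<)

  rank<⇒block≤ : ∀ {x y} → rank y < rank x → blockOf y ≤ blockOf x
  rank<⇒block≤ {x} {y} lt with rank<-view {x} {y} lt
  ... | inj₁ block<     = <⇒≤ block<
  ... | inj₂ (same , _) = ≤-reflexive same

  rank<⇒class≤ : ∀ {x y} → rank y < rank x → blockOf y ≡ blockOf x → class y ≤ class x
  rank<⇒class≤ {x} {y} lt same with rank<-view {x} {y} lt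
  ... | inj₁ block<                     = ⊥-elim (<⇒≢ block< same)
  ... | inj₂ (_ , inj₁ class<)          = <⇒≤ class<
  ... | inj₂ (_ , inj₂ (class≡ , _))    = ≤-reflexive class≡

  rank-injective : ∀ {x y} → rank y ≡ rank x → y ≡ x
  rank-injective {x} {y} eq = pos-injective (proj₂ (lex-injective n (key y) (key x) (pos y) (pos x) (pos<n y) (pos<n x) eq))

  open import Data.List.Membership.DecPropositional _≟V_ using () renaming (_∈?_ to _∈V?_)

  Conflict : V → V → Set
  Conflict x y = rank y < rank x × (blockOf y ≡ blockOf x ⊎ y ∈ backNbrs x)

  conflict? : ∀ x y → Dec (Conflict x y)
  conflict? x y = (rank y <? rank x) ×-dec ((blockOf y ≟ blockOf x) ⊎-dec (y ∈V? backNbrs x))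

  conflicts : V → List V
  conflicts x = filter (conflict? x) (allVtx m l)

  conflicts⁺ : ∀ {x y} → Conflict x y → y ∈ conflicts x
  conflicts⁺ {x} {y} = ∈-filter⁺ (conflict? x) (allVtx-complete y)

  conflicts⁻ : ∀ {x y} → y ∈ conflicts x → Conflict x y
  conflicts⁻ {x} y∈ = proj₂ (∈-filter⁻ (conflict? x) y∈)

  conflicts-unique : ∀ x → Unique (conflicts x)
  conflicts-unique x = Unique.filter⁺ (conflict? x) allVtx-unique

  conflict-earlier : ∀ {x y} → y ∈ conflicts x → rank y < rank x
  conflict-earlier {x} {y} y∈ = proj₁ (conflicts⁻ {x} {y} y∈)

  same-block-conflict : ∀ x y → blockOf x ≡ blockOf y → x ≢ y → y ∈ conflicts x ⊎ x ∈ conflicts y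
  same-block-conflict x y same x≢y with <-cmp (rank y) (rank x)
  ... | tri< y<x _ _ = inj₁ (conflicts⁺ {x} {y} (y<x , inj₁ (sym same)))
  ... | tri≈ _ y≡x _ = ⊥-elim (x≢y (sym (rank-injective {x} {y} y≡x)))
  ... | tri> _ _ x<y = inj₂ (conflicts⁺ {y} {x} (x<y , inj₁ same))

  -- A recorded back-neighbour is in conflict: if it is coloured later, it is either a mutual
  -- record or, having a smaller position yet a larger rank, it lies in the same block.
  recorded-conflict : ∀ x y → Recorded y x → x ≢ y → y ∈ conflicts x ⊎ x ∈ conflicts y
  recorded-conflict x y (y∈ , earlier-or-mutual) x≢y with <-cmp (rank y) (rank x)
  ... | tri< y<x _ _ = inj₁ (conflicts⁺ {x} {y} (y<x , inj₂ y∈))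
  ... | tri≈ _ y≡x _ = ⊥-elim (x≢y (sym (rank-injective {x} {y} y≡x)))
  ... | tri> _ _ x<y with earlier-or-mutual
  ...   | inj₂ x∈ = inj₂ (conflicts⁺ {y} {x} (x<y , inj₂ x∈))
  ...   | inj₁ pos< = inj₂ (conflicts⁺ {y} {x} (x<y , inj₁ (≤-antisym (rank<⇒block≤ {y} {x} x<y) (block-mono (<⇒≤ pos<)))))

  adjacent-conflict : ∀ {x y} → AdjSq m l x y → y ∈ conflicts x ⊎ x ∈ conflicts y
  adjacent-conflict {x} {y} adj@(x≢y , _) with square-edge-recorded adj
  ... | inj₂ y-rec = recorded-conflict x y y-rec x≢y
  ... | inj₁ x-rec with recorded-conflict y x x-rec (x≢y ∘ sym)
  ...   | inj₁ x∈ = inj₂ x∈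
  ...   | inj₂ y∈ = inj₁ y∈

  outDeg-inner : ∀ i j t → toℕ j ≡ suc t →
                 outDeg (br i j) ≡ length (filter (outside? (br i j)) (back1 i j ∷ second i j t ∷ []))
  outDeg-inner i j t e = cong (length ∘ filter (outside? (br i j))) (backNbrs-br i j e)

  outDeg≤2 : ∀ i j t → toℕ j ≡ suc t → outDeg (br i j) ≤ 2
  outDeg≤2 i j t e = subst (_≤ 2) (sym (outDeg-inner i j t e)) (length-filter (outside? (br i j)) (back1 i j ∷ second i j t ∷ []))

  class-start : ∀ i j → toℕ j ≡ 0 → class (br i j) ≡ 0
  class-start i j e = cong (λ a → classAt a (outDeg (br i j))) e

  class-inner : ∀ i j t → toℕ j ≡ suc t → class (br i j) ≡ 3 ∸ outDeg (br i j)
  class-inner i j t e = cong (λ a → classAt a (outDeg (br i j))) e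

  class-inner-positive : ∀ i j t → toℕ j ≡ suc t → 1 ≤ class (br i j)
  class-inner-positive i j t e = subst (1 ≤_) (sym (class-inner i j t e)) (∸-monoʳ-≤ 3 (outDeg≤2 i j t e))

  -- The hub: the root and the branch starts, which form a clique of G.
  hub : List V
  hub = root ∷ starts

  hub-length : length hub ≡ suc m
  hub-length = cong suc starts-length

  class0⇒hub : ∀ y → class y ≡ 0 → y ∈ hub
  class0⇒hub y class≡0 with shape y
  ... | root-shape          = here refl
  ... | start-shape i j e   = there (start∈starts i j e)
  ... | inner-shape i j t e = ⊥-elim (<⇒≢ (class-inner-positive i j t e) (sym class≡0))

  hub-backNbrs : ∀ x → class x ≡ 0 → ∀ {y} → y ∈ backNbrs x → y ∈ hub
  hub-backNbrs root     _       ()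
  hub-backNbrs (br i j) class≡0 {y} y∈ with shape (br i j)
  ... | start-shape _ _ e   = subst (y ∈_) (backNbrs-br i j e) y∈
  ... | inner-shape _ _ t e = ⊥-elim (<⇒≢ (class-inner-positive i j t e) (sym class≡0))

  -- A vertex of class 0 is only in conflict with hub vertices, so it has at most m + 1 conflicts.
  hub-room : ∀ x → class x ≡ 0 → length (conflicts x) ≤ k'
  hub-room x class≡0 = begin
    length (conflicts x) ≤⟨ subst (length (conflicts x) ≤_) hub-length (unique-⊆-length (conflicts-unique x) in-hub) ⟩
    suc m                ≤⟨ n≤1+n (suc m) ⟩
    2 + m                ≡⟨ +-comm 2 m ⟩
    m + 2                ≤⟨ m+2≤k' ⟩
    k'                   ∎
    where
    open ≤-Reasoning
    in-hub : ∀ {y} → y ∈ conflicts x → y ∈ hub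
    in-hub {y} y∈ with conflicts⁻ {x} {y} y∈
    ... | y<x , inj₁ same = class0⇒hub y (n≤0⇒n≡0 (subst (class y ≤_) class≡0 (rank<⇒class≤ {x} {y} y<x same)))
    ... | _   , inj₂ y∈nb = hub-backNbrs x class≡0 y∈nb

  EarlierInBlock : V → V → Set
  EarlierInBlock x y = rank y < rank x × blockOf y ≡ blockOf x

  earlierInBlock? : ∀ x y → Dec (EarlierInBlock x y)
  earlierInBlock? x y = (rank y <? rank x) ×-dec (blockOf y ≟ blockOf x)

  earlierInBlock : V → List V
  earlierInBlock x = filter (earlierInBlock? x) (allVtx m l)

  earlierInBlock⁻ : ∀ x {y} → y ∈ earlierInBlock x → EarlierInBlock x y
  earlierInBlock⁻ x y∈ = proj₂ (∈-filter⁻ (earlierInBlock? x) y∈)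

  earlierInBlock-unique : ∀ x → Unique (earlierInBlock x)
  earlierInBlock-unique x = Unique.filter⁺ (earlierInBlock? x) allVtx-unique

  conflicts-split : ∀ x → length (conflicts x) ≤ length (earlierInBlock x) + outDeg x
  conflicts-split x = subst (length (conflicts x) ≤_) (length-++ (earlierInBlock x))
                        (unique-⊆-length (conflicts-unique x) split)
    where
    split : ∀ {y} → y ∈ conflicts x → y ∈ earlierInBlock x ++ outsideNbrs x
    split {y} y∈ with conflicts⁻ {x} {y} y∈
    ... | y<x , inj₁ same = ∈-++⁺ˡ (∈-filter⁺ (earlierInBlock? x) (allVtx-complete y) (y<x , same))
    ... | y<x , inj₂ y∈nb with blockOf y ≟ blockOf x
    ...   | yes same = ∈-++⁺ˡ (∈-filter⁺ (earlierInBlock? x) (allVtx-complete y) (y<x , same))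
    ...   | no other = ∈-++⁺ʳ (earlierInBlock x) (∈-filter⁺ (outside? x) y∈nb other)

  block-count : ∀ b c {xs : List V} → Unique xs → (∀ {y} → y ∈ xs → blockOf y ≡ b) →
                (∀ {y} → y ∈ xs → pos y < b * k + c) → length xs ≤ c
  block-count = block-capacity pos pos-injective

  in-own-block : ∀ y → pos y < blockOf y * k + k
  in-own-block y = proj₂ (block-bounds (pos y))

  self-and-earlier-unique : ∀ x → Unique (x ∷ earlierInBlock x)
  self-and-earlier-unique x = All.tabulate (λ y∈ x≡y → <-irrefl (cong rank (sym x≡y)) (proj₁ (earlierInBlock⁻ x y∈)))
                    ∷ earlierInBlock-unique x

  self-and-earlier-in-block : ∀ x {y} → y ∈ x ∷ earlierInBlock x → blockOf y ≡ blockOf x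
  self-and-earlier-in-block x (here refl) = refl
  self-and-earlier-in-block x (there y∈)  = proj₂ (earlierInBlock⁻ x y∈)

  earlierInBlock-room : ∀ x → length (earlierInBlock x) ≤ k'
  earlierInBlock-room x = ≤-pred (block-count (blockOf x) k (self-and-earlier-unique x) (self-and-earlier-in-block x)
                            (λ {y} y∈ → subst (λ b → pos y < b * k + k) (self-and-earlier-in-block x y∈) (in-own-block y)))

  earlierInBlock-room⁺ : ∀ x → n ≤ blockOf x * k + k' ⊎ Σ V (λ z → blockOf z ≡ blockOf x × rank x < rank z) →
                         suc (length (earlierInBlock x)) ≤ k'
  earlierInBlock-room⁺ x (inj₁ partial) =
    block-count (blockOf x) k' (self-and-earlier-unique x) (self-and-earlier-in-block x) (λ {y} _ → ≤-trans (pos<n y) partial)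
  earlierInBlock-room⁺ x (inj₂ (z , z-in-block , x<z)) =
    ≤-pred (block-count (blockOf x) k unique in-block (λ {y} y∈ → subst (λ b → pos y < b * k + k) (in-block y∈) (in-own-block y)))
    where
    unique : Unique (x ∷ z ∷ earlierInBlock x)
    unique = All.tabulate x-fresh ∷ (All.tabulate z-fresh ∷ earlierInBlock-unique x)
      where
      x-fresh : ∀ {y} → y ∈ z ∷ earlierInBlock x → x ≢ y
      x-fresh (here refl) x≡z = <-irrefl (cong rank x≡z) x<z
      x-fresh (there y∈)  x≡y = <-irrefl (cong rank (sym x≡y)) (proj₁ (earlierInBlock⁻ x y∈))
      z-fresh : ∀ {y} → y ∈ earlierInBlock x → z ≢ y
      z-fresh y∈ z≡y = <-asym x<z (subst (λ w → rank w < rank x) (sym z≡y) (proj₁ (earlierInBlock⁻ x y∈)))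
    in-block : ∀ {y} → y ∈ x ∷ z ∷ earlierInBlock x → blockOf y ≡ blockOf x
    in-block (here refl)         = refl
    in-block (there (here refl)) = z-in-block
    in-block (there (there y∈))  = proj₂ (earlierInBlock⁻ x y∈)

  back1-same-block : ∀ i j t → toℕ j ≡ suc t → 1 ≤ slot (pos (br i j)) → blockOf (back1 i j) ≡ blockOf (br i j)
  back1-same-block i j t e 1≤slot = trans (cong block (pos-back1 i j t e)) (block-∸ (pos (br i j)) 1 1≤slot)

  outDeg≡2⇒slot0 : ∀ i j t → toℕ j ≡ suc t → outDeg (br i j) ≡ 2 → slot (pos (br i j)) ≡ 0
  outDeg≡2⇒slot0 i j t e both-outside with slot (pos (br i j)) ≟ 0
  ... | yes slot≡0 = slot≡0
  ... | no  slot≢0 = ⊥-elim (back1-outside (back1-same-block i j t e (n≢0⇒n>0 slot≢0)))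
    where
    back1-outside : blockOf (back1 i j) ≢ blockOf (br i j)
    back1-outside = filter-keeps-all (outside? (br i j)) (back1 i j ∷ second i j t ∷ [])
                      (trans (sym (outDeg-inner i j t e)) both-outside) (here refl)

  outside⇒late-block : ∀ i j t → toℕ j ≡ suc t → 1 ≤ outDeg (br i j) → 1 ≤ blockOf (br i j)
  outside⇒late-block i j t e some-outside with member-of-nonempty (outsideNbrs (br i j)) some-outside
  ... | y , y∈ with ∈-filter⁻ (outside? (br i j)) y∈
  ...   | y∈nb , other = ≤-trans (s≤s z≤n) (≤∧≢⇒< (block-mono (<⇒≤ (backNbrs-earlier i j t e y∈nb))) other)

  deep-class3 : ∀ i j t → toℕ j ≡ suc (suc t) → 2 ≤ slot (pos (br i j)) → class (br i j) ≡ 3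
  deep-class3 i j t e 2≤slot = trans (class-inner i j (suc t) e) (cong (3 ∸_) no-outside)
    where
    same1 : blockOf (back1 i j) ≡ blockOf (br i j)
    same1 = back1-same-block i j (suc t) e (≤-trans (s≤s z≤n) 2≤slot)
    same2 : blockOf (back2 i j) ≡ blockOf (br i j)
    same2 = trans (cong block (pos-back2 i j t e)) (block-∸ (pos (br i j)) 2 2≤slot)
    no-outside : outDeg (br i j) ≡ 0
    no-outside = trans (outDeg-inner i j (suc t) e)
                   (cong length (filter-none (outside? (br i j)) {back1 i j ∷ back2 i j ∷ []} ((λ other → other same1) ∷ (λ other → other same2) ∷ [])))

  Shallow : ℕ → Set
  Shallow q = Σ (Fin m) λ i → Σ (Fin (l i)) λ j → pos (br i j) ≡ q × toℕ j ≤ 1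

  Class3In : ℕ → Set
  Class3In b = Σ V λ z → blockOf z ≡ b × class z ≡ 3

  class3-or-shallow : ∀ q → q < n → 0 < q → 2 ≤ slot q → Class3In (block q) ⊎ Shallow q
  class3-or-shallow q q<n 0<q 2≤slot with vertexAt q q<n
  ... | root   , refl = ⊥-elim (<-irrefl refl 0<q)
  ... | br i j , refl with shape (br i j)
  ...   | start-shape _ _ e          = inj₂ (i , j , refl , subst (_≤ 1) (sym e) z≤n)
  ...   | inner-shape _ _ zero e     = inj₂ (i , j , refl , ≤-reflexive e)
  ...   | inner-shape _ _ (suc t) e  = inj₁ (br i j , refl , deep-class3 i j t e 2≤slot)

  -- If a shallow vertex of branch i sits at the last slot of block b ≥ 1, the position
  -- just before branch i is still at slot ≥ 2 of block b and beyond 2m; a shallow vertex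
  -- there is excluded by short-prefix, so a class-3 vertex of block b is found.
  before-shallow-class3 : ∀ b → 1 ≤ b → k' + b * k < n → ∀ i (j : Fin (l i)) → toℕ j ≤ 1 →
                          pos (br i j) ≡ k' + b * k → Class3In b
  before-shallow-class3 b 1≤b last<n i j j≤1 at-last =
    finish (class3-or-shallow (offset l i) s<n 0<s (subst (2 ≤_) (sym slot-s) 2≤r))
    where
    a r : ℕ
    a = toℕ j
    r = k' ∸ suc a
    suc-a≤k' : suc a ≤ k'
    suc-a≤k' = ≤-trans (s≤s j≤1) 2≤k'
    s≡ : offset l i ≡ r + b * k
    s≡ = begin
      offset l i                    ≡⟨ m+n∸n≡m (offset l i) (suc a) ⟨
      offset l i + suc a ∸ suc a    ≡⟨ cong (_∸ suc a) (trans (+-suc (offset l i) a) at-last) ⟩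
      k' + b * k ∸ suc a            ≡⟨ +-∸-comm (b * k) suc-a≤k' ⟩
      r + b * k                     ∎
      where open ≡-Reasoning
    r<k : r < k
    r<k = s≤s (m∸n≤m k' (suc a))
    m≤r : m ≤ r
    m≤r = ≤-trans (m+n≤o⇒m≤o∸n m m+2≤k') (∸-monoʳ-≤ k' (s≤s j≤1))
    2≤r : 2 ≤ r
    2≤r = ≤-trans (≤-trans (n≤1+n 2) 3≤m) m≤r
    slot-s : slot (offset l i) ≡ r
    slot-s = trans (cong slot s≡) (slot-of b r r<k)
    m+m<s : m + m < offset l i
    m+m<s = subst (m + m <_) (sym s≡) (+-mono-≤-< m≤r (≤-trans (s≤s (≤-trans (m≤m+n m 2) m+2≤k')) (k≤b*k b 1≤b)))
    0<s : 0 < offset l i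
    0<s = ≤-<-trans z≤n m+m<s
    s<n : offset l i < n
    s<n = <-trans (subst (offset l i <_) at-last (s≤s (m≤m+n (offset l i) a))) last<n
    finish : Class3In (block (offset l i)) ⊎ Shallow (offset l i) → Class3In b
    finish (inj₁ (z , z-in , class3))    = z , trans z-in (trans (cong block s≡) (block-of b r r<k)) , class3
    finish (inj₂ (i' , j' , at-s , j'≤1)) = ⊥-elim (<⇒≱ m+m<s (short-prefix mono i i' j' j'≤1 at-s))

  -- Every full block other than block 0 contains a vertex of class 3: its last slot holds
  -- one, or holds a shallow vertex and before-shallow-class3 applies.
  full-block-class3 : ∀ b → 1 ≤ b → b * k + k ≤ n → Class3In b
  full-block-class3 b 1≤b full =
    finish (class3-or-shallow (k' + b * k) last<n 0<last (subst (2 ≤_) (sym (slot-of b k' ≤-refl)) 2≤k'))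
    where
    last<n : k' + b * k < n
    last<n = subst (_≤ n) (+-comm (b * k) k) full
    0<last : 0 < k' + b * k
    0<last = ≤-trans (s≤s z≤n) (≤-trans (k≤b*k b 1≤b) (m≤n+m (b * k) k'))
    finish : Class3In (block (k' + b * k)) ⊎ Shallow (k' + b * k) → Class3In b
    finish (inj₁ (z , z-in , class3))      = z , trans z-in (block-of b k' ≤-refl) , class3
    finish (inj₂ (i , j , at-last , j≤1)) = before-shallow-class3 b 1≤b last<n i j j≤1 at-last

  -- One outside back-neighbour: x has class 2, and a later vertex of its block (of class 3)
  -- exists unless the block is not full.
  one-outside-room : ∀ i j t → toℕ j ≡ suc t → outDeg (br i j) ≡ 1 →
                     suc (length (earlierInBlock (br i j))) ≤ k'
  one-outside-room i j t e one with n ≤? blockOf (br i j) * k + k'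
  ... | yes partial = earlierInBlock-room⁺ (br i j) (inj₁ partial)
  ... | no  full    = earlierInBlock-room⁺ (br i j) (inj₂ (z , z-in , later))
    where
    x : V
    x = br i j
    class3 : Class3In (blockOf x)
    class3 = full-block-class3 (blockOf x) (outside⇒late-block i j t e (≤-reflexive (sym one)))
               (subst (_≤ n) (sym (+-suc (blockOf x * k) k')) (≰⇒> full))
    z : V
    z = proj₁ class3
    z-in : blockOf z ≡ blockOf x
    z-in = proj₁ (proj₂ class3)
    later : rank x < rank z
    later = rank-class< {z} {x} (sym z-in)
              (subst₂ _<_ (sym (trans (class-inner i j t e) (cong (3 ∸_) one))) (sym (proj₂ (proj₂ class3))) ≤-refl)

  3∸d≤1⇒d≡2 : ∀ d → d ≤ 2 → 3 ∸ d ≤ 1 → d ≡ 2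
  3∸d≤1⇒d≡2 0 _ (s≤s ())
  3∸d≤1⇒d≡2 1 _ (s≤s ())
  3∸d≤1⇒d≡2 2 _ _ = refl
  3∸d≤1⇒d≡2 (suc (suc (suc _))) (s≤s (s≤s ())) _

  -- Both back-neighbours outside: x is at slot 0 and has class 1, so the earlier vertices of
  -- its block have class 0 (another class-1 vertex would also sit at slot 0): they are starts.
  two-outside-room : ∀ i j t → toℕ j ≡ suc t → outDeg (br i j) ≡ 2 → length (earlierInBlock (br i j)) ≤ m
  two-outside-room i j t e two =
    subst (length (earlierInBlock x) ≤_) starts-length (unique-⊆-length (earlierInBlock-unique x) only-starts)
    where
    x : V
    x = br i j
    class1 : class x ≡ 1
    class1 = trans (class-inner i j t e) (cong (3 ∸_) two)
    only-starts : ∀ {y} → y ∈ earlierInBlock x → y ∈ starts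
    only-starts {y} y∈ with earlierInBlock⁻ x y∈ | shape y
    ... | _ , same | root-shape = ⊥-elim (<⇒≢ (outside⇒late-block i j t e (subst (1 ≤_) (sym two) (s≤s z≤n))) same)
    ... | _ , _    | start-shape i' j' e' = start∈starts i' j' e'
    ... | y<x , same | inner-shape i' j' t' e' = ⊥-elim (<-irrefl (cong rank y≡x) y<x)
      where
      class≤1 : 3 ∸ outDeg y ≤ 1
      class≤1 = subst₂ _≤_ (class-inner i' j' t' e') class1 (rank<⇒class≤ {x} {y} y<x same)
      two' : outDeg y ≡ 2
      two' = 3∸d≤1⇒d≡2 (outDeg y) (outDeg≤2 i' j' t' e') class≤1
      y≡x : y ≡ x
      y≡x = pos-injective (block-slot-injective same
              (trans (outDeg≡2⇒slot0 i' j' t' e' two') (sym (outDeg≡2⇒slot0 i j t e two))))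

  inner-room : ∀ i j t → toℕ j ≡ suc t → length (conflicts (br i j)) ≤ k'
  inner-room i j t e = ≤-trans (conflicts-split x) (by-outDeg (outDeg x) refl)
    where
    x : V
    x = br i j
    by-outDeg : ∀ d → outDeg x ≡ d → length (earlierInBlock x) + outDeg x ≤ k'
    by-outDeg 0 d≡ = subst (λ d → length (earlierInBlock x) + d ≤ k') (sym d≡)
      (subst (_≤ k') (sym (+-identityʳ _)) (earlierInBlock-room x))
    by-outDeg 1 d≡ = subst (λ d → length (earlierInBlock x) + d ≤ k') (sym d≡)
      (subst (_≤ k') (+-comm 1 _) (one-outside-room i j t e d≡))
    by-outDeg 2 d≡ = subst (λ d → length (earlierInBlock x) + d ≤ k') (sym d≡)
      (≤-trans (+-monoˡ-≤ 2 (two-outside-room i j t e d≡)) m+2≤k')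
    by-outDeg (suc (suc (suc _))) d≡ = ⊥-elim (<⇒≱ (s≤s (s≤s (s≤s z≤n))) (subst (_≤ 2) d≡ (outDeg≤2 i j t e)))

  room : ∀ x → length (conflicts x) < k
  room x with shape x
  ... | root-shape          = s≤s (hub-room root refl)
  ... | start-shape i j e   = s≤s (hub-room (br i j) (class-start i j e))
  ... | inner-shape i j t e = s≤s (inner-room i j t e)

  proper : (f : V → ℕ) → (∀ {x y} → y ∈ conflicts x → f y ≢ f x) →
           (x y : V) → AdjSq m l x y → f x ≢ f y
  proper f respects x y adj with adjacent-conflict adj
  ... | inj₁ y∈ = respects y∈ ∘ sym
  ... | inj₂ x∈ = respects x∈

  -- ... and equitable: a colour class meets every block at most once.
  equitable : (f : V → ℕ) → (∀ {x y} → y ∈ conflicts x → f y ≢ f x) →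
              ∀ c → colourCount m l f c ≤ ceilDiv n k
  equitable f respects c = one-per-block pos n (Unique.filter⁺ (λ v → f v ≟ c) allVtx-unique)
                             (λ {x} _ → pos<n x) one-per-block-of-class
    where
    coloured-c : ∀ {x} → x ∈ filter (λ v → f v ≟ c) (allVtx m l) → f x ≡ c
    coloured-c x∈ = proj₂ (∈-filter⁻ (λ v → f v ≟ c) x∈)
    one-per-block-of-class : ∀ {x y} → x ∈ filter (λ v → f v ≟ c) (allVtx m l) → y ∈ filter (λ v → f v ≟ c) (allVtx m l) →
                             blockOf x ≡ blockOf y → x ≡ y
    one-per-block-of-class {x} {y} x∈ y∈ same with x ≟V y
    ... | yes x≡y = x≡y
    ... | no  x≢y with same-block-conflict x y same x≢y
    ...   | inj₁ y-conflict = ⊥-elim (respects y-conflict (trans (coloured-c y∈) (sym (coloured-c x∈))))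
    ...   | inj₂ x-conflict = ⊥-elim (respects x-conflict (trans (coloured-c x∈) (sym (coloured-c y∈))))

  equitable-colouring : (L : V → List ℕ) → IsKAssignment m l k L → Σ (V → ℕ) (IsEquitableLColouring m l k L)
  equitable-colouring L is-assignment with greedy-colouring rank conflicts (λ {x} {y} → conflict-earlier {x} {y})
    L (proj₁ ∘ is-assignment) (λ x → subst (length (conflicts x) <_) (sym (proj₂ (is-assignment x))) (room x))
  ... | f , f∈L , respects = f , f∈L , proper f respects , equitable f respects

lemma2p3 : (m : ℕ) → 3 ≤ m → (l : Fin m → ℕ) →
    ((i : Fin m) → 1 ≤ l i) →
    ((i j : Fin m) → i ≤ᶠ j → l i ≤ l j) →
    (k : ℕ) → m + 3 ≤ k → EquitablyChoosableSq m l k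
lemma2p3 m _ l _ _ zero m+3≤0 with ≤-trans (m≤n+m 3 m) m+3≤0
... | ()
lemma2p3 m 3≤m l nonempty mono (suc k') m+3≤k =
  Ordering.equitable-colouring m 3≤m l nonempty mono k' m+3≤k
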